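{- For any non-empty string $S$, $|\mathcal{IS}_S| \leq 2|S| - |\mathcal{M}_S|$.
   Context: For a string $S$ of length $n$ and $1 \le i \le j \le n$, $S[i..j]$ is the substring from position $i$ to position $j$; a non-empty substring is unique if it occurs exactly once in $S$ and repeating if it occurs at least twice; an interval $[i,j]$ is unique/repeating according to $S[i..j]$. An interval $[i,j]$ is a minimal unique substring (MUS) if $S[i..j]$ is unique and every proper substring $S[i'..j']$ ($i\le i'$, $j'\le j$, $j'-i'<j-i$) is repeating; $\mathcal{M}_S$ is the set of all MUS intervals. $[s,t]\subset[i,j]$ means $i\le s$ and $t\le j$. For $1\le s\le t\le n$, an interval $[i,j]$ is a shortest unique substring (SUS) for $[s,t]$ if $S[i..j]$ is unique, $[s,t]\subset[i,j]$, and $S[i'..j']$ is repeating for every $[i',j']\supset[s,t]$ with $j'-i'<j-i$; $\mathsf{SUS}_S([s,t])$ is the set of SUSs for $[s,t]$. If $s\ne t$ and $[s,t]$ is unique, then $[s,t]$ is its own only SUS, called a trivial SUS; all other SUSs are non-trivial. $\mathcal{IS}_S$ is the set of all non-trivial SUSs of $S$, i.e. the union of $\mathsf{SUS}_S([s,t])$ over all query intervals $1\le s\le t\le n$ except those with $s\ne t$ and $[s,t]$ unique. -}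

module Defs where

open import Data.Nat using (ℕ; zero; suc; _+_; _*_; _∸_; _≤_; _<_; _≤?_; _<?_)
open import Data.Nat.Properties using (≤-refl; m≤n⇒m<n∨m≡n; <-trans; n<1+n)
import Data.Nat.Properties as ℕP
open import Data.List using (List; []; _∷_; length; take; drop; filter; upTo; cartesianProduct)
open import Data.List.Properties using (≡-dec)
open import Data.Product using (Σ; ∃; _×_; _,_; proj₁; proj₂)
open import Data.Sum using (inj₁; inj₂)
open import Relation.Binary.PropositionalEquality using (_≡_; _≢_; refl)
open import Relation.Binary.Definitions using (DecidableEquality)
open import Relation.Nullary using (Dec; yes; no; ¬_)
open import Relation.Nullary.Decidable using (_×-dec_; _→-dec_; ¬?)

-- A string S over an alphabet A is a List A, n = length S,
-- positions are 1-based (as in the paper).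

module _ {A : Set} where

  -- S[i..j]  (1-based, inclusive)
  substr : List A → ℕ → ℕ → List A
  substr S i j = take (suc j ∸ i) (drop (i ∸ 1) S)

  Valid : List A → ℕ → ℕ → Set
  Valid S i j = (1 ≤ i) × (i ≤ j) × (j ≤ length S)

  Occ : List A → ℕ → ℕ → ℕ → Set
  Occ S i j p = (1 ≤ p) × (p + (j ∸ i) ≤ length S)
                × (substr S p (p + (j ∸ i)) ≡ substr S i j)

  -- [i,j] is unique: S[i..j] occurs exactly once in S
  -- (its occurrence at i is the only one).
  -- (Every occurrence p satisfies p ≤ |S|, so the bound p < |S|+1 is harmless.)
  Unique : List A → ℕ → ℕ → Set
  Unique S i j = Occ S i j i × (∀ p → p < suc (length S) → Occ S i j p → p ≡ i)

  Repeating : List A → ℕ → ℕ → Set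
  Repeating S i j = Occ S i j i × ∃ λ p → p < suc (length S) × Occ S i j p × p ≢ i

  MUS : List A → ℕ → ℕ → Set
  MUS S i j = Valid S i j × Unique S i j
    × (∀ i' → i' < suc (length S) → ∀ j' → j' < suc (length S) →
         i ≤ i' → j' ≤ j → i' ≤ j' → j' ∸ i' < j ∸ i → Repeating S i' j')

  SUS : List A → ℕ → ℕ → ℕ → ℕ → Set
  SUS S s t i j = Valid S i j × Unique S i j × (i ≤ s) × (t ≤ j)
    × (∀ i' → i' < suc (length S) → ∀ j' → j' < suc (length S) →
         Valid S i' j' → i' ≤ s → t ≤ j' → j' ∸ i' < j ∸ i → Repeating S i' j')

  NonTrivialQuery : List A → ℕ → ℕ → Set
  NonTrivialQuery S s t = Valid S s t × ¬ ((s ≢ t) × Unique S s t)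

  IS : List A → ℕ → ℕ → Set
  IS S i j = ∃ λ s → s < suc (length S) × ∃ λ t → t < suc (length S)
             × NonTrivialQuery S s t × SUS S s t i j

all<? : {P : ℕ → Set} → (∀ p → Dec (P p)) → ∀ m → Dec (∀ p → p < m → P p)
all<? P? zero = yes (λ p ())
all<? {P} P? (suc m) with all<? P? m | P? m
... | no ¬a | _ = no λ f → ¬a (λ p p<m → f p (ℕP.m<n⇒m<1+n p<m))
... | yes a | no ¬pm = no λ f → ¬pm (f m ≤-refl)
... | yes a | yes pm = yes g
  where
  g : ∀ p → p < suc m → P p
  g p (Data.Nat.s≤s p≤m) with m≤n⇒m<n∨m≡n p≤m
  ... | inj₁ p<m = a p p<m
  ... | inj₂ refl = pm

any<? : {P : ℕ → Set} → (∀ p → Dec (P p)) → ∀ m → Dec (∃ λ p → p < m × P p)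
any<? P? zero = no λ { (p , () , _) }
any<? {P} P? (suc m) with any<? P? m | P? m
... | yes (p , p<m , pp) | _ = yes (p , ℕP.m<n⇒m<1+n p<m , pp)
... | no _ | yes pm = yes (m , ≤-refl , pm)
... | no ¬e | no ¬pm = no h
  where
  h : ¬ (∃ λ p → p < suc m × P p)
  h (p , Data.Nat.s≤s p≤m , pp) with m≤n⇒m<n∨m≡n p≤m
  ... | inj₁ p<m = ¬e (p , p<m , pp)
  ... | inj₂ refl = ¬pm pp

module _ {A : Set} (_≟_ : DecidableEquality A) (S : List A) where

  private
    n = length S
    _≟ℕ_ = ℕP._≟_

  Occ? : ∀ i j p → Dec (Occ S i j p)
  Occ? i j p = (1 ≤? p) ×-dec (p + (j ∸ i) ≤? n)
             ×-dec ≡-dec _≟_ (substr S p (p + (j ∸ i))) (substr S i j)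

  Valid? : ∀ i j → Dec (Valid S i j)
  Valid? i j = (1 ≤? i) ×-dec (i ≤? j) ×-dec (j ≤? n)

  Unique? : ∀ i j → Dec (Unique S i j)
  Unique? i j = Occ? i j i ×-dec all<? (λ p → Occ? i j p →-dec (p ≟ℕ i)) (suc n)

  Repeating? : ∀ i j → Dec (Repeating S i j)
  Repeating? i j = Occ? i j i ×-dec
    any<? (λ p → Occ? i j p ×-dec ¬? (p ≟ℕ i)) (suc n)

  MUS? : ∀ i j → Dec (MUS S i j)
  MUS? i j = Valid? i j ×-dec Unique? i j ×-dec
    all<? (λ i' → all<? (λ j' →
       (i ≤? i') →-dec (j' ≤? j) →-dec (i' ≤? j') →-dec (j' ∸ i' <? j ∸ i)
       →-dec Repeating? i' j') (suc n)) (suc n)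

  SUS? : ∀ s t i j → Dec (SUS S s t i j)
  SUS? s t i j = Valid? i j ×-dec Unique? i j ×-dec (i ≤? s) ×-dec (t ≤? j) ×-dec
    all<? (λ i' → all<? (λ j' →
       Valid? i' j' →-dec (i' ≤? s) →-dec (t ≤? j') →-dec (j' ∸ i' <? j ∸ i)
       →-dec Repeating? i' j') (suc n)) (suc n)

  NonTrivialQuery? : ∀ s t → Dec (NonTrivialQuery S s t)
  NonTrivialQuery? s t = Valid? s t ×-dec ¬? (¬? (s ≟ℕ t) ×-dec Unique? s t)

  IS? : ∀ i j → Dec (IS S i j)
  IS? i j = any<? (λ s → any<? (λ t →
              NonTrivialQuery? s t ×-dec SUS? s t i j) (suc n)) (suc n)

-- Cardinality of a decidable set of intervals of a string of length n:
-- the number of pairs (i , j) with 0 ≤ i , j ≤ n satisfying P.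
-- (All our sets only contain valid intervals 1 ≤ i ≤ j ≤ n.)

allPairs : ℕ → List (ℕ × ℕ)
allPairs n = cartesianProduct (upTo (suc n)) (upTo (suc n))

card : (P : ℕ → ℕ → Set) → (∀ i j → Dec (P i j)) → ℕ → ℕ
card P P? n = length (filter {P = λ x → P (proj₁ x) (proj₂ x)}
                              (λ x → P? (proj₁ x) (proj₂ x)) (allPairs n))

#MUS : {A : Set} → DecidableEquality A → List A → ℕ
#MUS _≟_ S = card (MUS S) (MUS? _≟_ S) (length S)

#IS : {A : Set} → DecidableEquality A → List A → ℕ
#IS _≟_ S = card (IS S) (IS? _≟_ S) (length S)

module Submission where

-- Call a unique interval [i,j] left-minimal if i = j or [i+1,j] is repeating, and
-- right-minimal if i = j or [i,j-1] is repeating.  Every substring of a repeating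
-- substring repeats, so for each end j at most one start i makes [i,j] left-minimal,
-- and symmetrically; hence there are at most |S| intervals of each kind.  A MUS is
-- both left- and right-minimal, while a non-trivial SUS [i,j] of [s,t] is
-- left-minimal if i < s, right-minimal if t < j, and otherwise i = s = t = j.
-- So |IS| + |M| ≤ |L ∪ R| + |L ∩ R| = |L| + |R| ≤ 2|S|.

open import Defs
open import Data.Nat using (ℕ; zero; suc; pred; _+_; _*_; _∸_; _⊓_; _≤_; _<_; _<?_; s≤s; z≤n)
open import Data.Nat.Properties
open import Data.List using (List; []; _∷_; length; take; drop; filter; map)
open import Data.List.Properties using (take-take; take-drop; drop-drop; length-map; filter-all; filter-accept; filter-reject)
open import Data.List.Relation.Unary.All as All using (All; []; _∷_)
open import Data.List.Relation.Unary.All.Properties as All using (all-filter)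
open import Data.List.Relation.Unary.Unique.Propositional using ([]; _∷_) renaming (Unique to Distinct)
import Data.List.Relation.Unary.Unique.Propositional.Properties as Distinct
open import Data.List.Relation.Binary.Sublist.Propositional using (⊆-refl)
import Data.List.Relation.Binary.Sublist.Propositional.Properties as Sublist
open import Data.Product using (_×_; _,_; proj₁; proj₂)
open import Data.Sum using (_⊎_; inj₁; inj₂)
open import Data.Empty using (⊥-elim)
open import Function using (_∘_)
open import Relation.Binary.PropositionalEquality
open import Relation.Binary.Definitions using (DecidableEquality)
open import Relation.Nullary using (Dec; yes; no; ¬_)
open import Relation.Nullary.Decidable using (_×-dec_; _⊎-dec_; _→-dec_; ¬?)
open import Relation.Unary using (Pred; Decidable; _⊆_)

j∸i≡[k∸i]+[j∸k] : ∀ {i k j} → i ≤ k → k ≤ j → j ∸ i ≡ (k ∸ i) + (j ∸ k)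
j∸i≡[k∸i]+[j∸k] {i} {k} {j} i≤k k≤j = begin
  j ∸ i                ≡⟨ cong (_∸ i) (m∸n+n≡m k≤j) ⟨
  (j ∸ k) + k ∸ i      ≡⟨ +-∸-assoc (j ∸ k) i≤k ⟩
  (j ∸ k) + (k ∸ i)    ≡⟨ +-comm (j ∸ k) (k ∸ i) ⟩
  (k ∸ i) + (j ∸ k)    ∎
  where open ≡-Reasoning

i∸1+[k∸i]≡k∸1 : ∀ {i k} → 1 ≤ i → i ≤ k → (i ∸ 1) + (k ∸ i) ≡ k ∸ 1
i∸1+[k∸i]≡k∸1 {suc i} {suc k} _ i≤k = m+[n∸m]≡n (≤-pred i≤k)

j∸[1+i]<j∸i : ∀ {i j} → i < j → j ∸ suc i < j ∸ i
j∸[1+i]<j∸i {i} i<j = ∸-monoʳ-< (n<1+n i) i<j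

pred[j]∸i<j∸i : ∀ {i j} → i < j → pred j ∸ i < j ∸ i
pred[j]∸i<j∸i {i} {suc j} i<j = ∸-monoˡ-< (n<1+n j) (≤-pred i<j)

module _ {A : Set} where

  take-prefix : ∀ {m L} (xs ys : List A) → m ≤ L →
                take L xs ≡ take L ys → take m xs ≡ take m ys
  take-prefix {m} {L} xs ys m≤L eq = begin
    take m xs             ≡⟨ cong (λ k → take k xs) (m≤n⇒m⊓n≡m m≤L) ⟨
    take (m ⊓ L) xs       ≡⟨ take-take m L xs ⟨
    take m (take L xs)    ≡⟨ cong (take m) eq ⟩
    take m (take L ys)    ≡⟨ take-take m L ys ⟩
    take (m ⊓ L) ys       ≡⟨ cong (λ k → take k ys) (m≤n⇒m⊓n≡m m≤L) ⟩
    take m ys             ∎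
    where open ≡-Reasoning

  take-suffix : ∀ c m a b (xs : List A) →
                take (c + m) (drop a xs) ≡ take (c + m) (drop b xs) →
                take m (drop (a + c) xs) ≡ take m (drop (b + c) xs)
  take-suffix c m a b xs eq = begin
    take m (drop (a + c) xs)             ≡⟨ cong (take m) (drop-drop a c xs) ⟨
    take m (drop c (drop a xs))          ≡⟨ take-drop m c (drop a xs) ⟩
    drop c (take (c + m) (drop a xs))    ≡⟨ cong (drop c) eq ⟩
    drop c (take (c + m) (drop b xs))    ≡⟨ take-drop m c (drop b xs) ⟨
    take m (drop c (drop b xs))          ≡⟨ cong (take m) (drop-drop b c xs) ⟩
    take m (drop (b + c) xs)             ∎
    where open ≡-Reasoning

module _ {A : Set} {S : List A} where

  substr-window : ∀ {i j} → i ≤ j → substr S i j ≡ take (suc (j ∸ i)) (drop (i ∸ 1) S)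
  substr-window {i} i≤j = cong (λ L → take L (drop (i ∸ 1) S)) (+-∸-assoc 1 i≤j)

  substr-from : ∀ p d → substr S p (p + d) ≡ take (suc d) (drop (p ∸ 1) S)
  substr-from p d = trans (substr-window (m≤m+n p d))
                          (cong (λ k → take (suc k) (drop (p ∸ 1) S)) (m+n∸m≡n p d))

  Occ⇒window : ∀ {i j p} → i ≤ j → Occ S i j p →
               take (suc (j ∸ i)) (drop (p ∸ 1) S) ≡ take (suc (j ∸ i)) (drop (i ∸ 1) S)
  Occ⇒window {i} {j} {p} i≤j (_ , _ , eq) =
    trans (sym (substr-from p (j ∸ i))) (trans eq (substr-window i≤j))

  window⇒Occ : ∀ {i j p} → i ≤ j → 1 ≤ p → p + (j ∸ i) ≤ length S →
               take (suc (j ∸ i)) (drop (p ∸ 1) S) ≡ take (suc (j ∸ i)) (drop (i ∸ 1) S) →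
               Occ S i j p
  window⇒Occ {i} {j} {p} i≤j 1≤p bound eq =
    1≤p , bound , trans (substr-from p (j ∸ i)) (trans eq (sym (substr-window i≤j)))

  Occ⇒< : ∀ {i j p} → Occ S i j p → p < suc (length S)
  Occ⇒< (_ , bound , _) = s≤s (≤-trans (m≤m+n _ _) bound)

  Occ-prefix : ∀ {i k j p} → i ≤ k → k ≤ j → Occ S i j p → Occ S i k p
  Occ-prefix {i = i} {p = p} i≤k k≤j occ@(1≤p , bound , _) =
    window⇒Occ i≤k 1≤p (≤-trans (+-monoʳ-≤ p k∸i≤j∸i) bound)
      (take-prefix _ _ (s≤s k∸i≤j∸i) (Occ⇒window (≤-trans i≤k k≤j) occ))
    where k∸i≤j∸i = ∸-monoˡ-≤ i k≤j

  -- 1 ≤ i is needed: drop (i ∸ 1) does not distinguish the positions 0 and 1.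
  Occ-suffix : ∀ {i k j p} → 1 ≤ i → i ≤ k → k ≤ j → Occ S i j p → Occ S k j (p + (k ∸ i))
  Occ-suffix {i} {k} {j} {p} 1≤i i≤k k≤j occ@(1≤p , bound , _) =
    window⇒Occ k≤j (≤-trans 1≤p (m≤m+n p (k ∸ i))) bound′ window′
    where
      split = j∸i≡[k∸i]+[j∸k] i≤k k≤j
      bound′ : p + (k ∸ i) + (j ∸ k) ≤ length S
      bound′ = subst (_≤ length S) (trans (cong (p +_) split) (sym (+-assoc p (k ∸ i) (j ∸ k)))) bound
      window : take ((k ∸ i) + suc (j ∸ k)) (drop (p ∸ 1) S)
             ≡ take ((k ∸ i) + suc (j ∸ k)) (drop (i ∸ 1) S)
      window = subst (λ L → take L (drop (p ∸ 1) S) ≡ take L (drop (i ∸ 1) S))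
                 (trans (cong suc split) (sym (+-suc (k ∸ i) (j ∸ k))))
                 (Occ⇒window (≤-trans i≤k k≤j) occ)
      window′ : take (suc (j ∸ k)) (drop (p + (k ∸ i) ∸ 1) S) ≡ take (suc (j ∸ k)) (drop (k ∸ 1) S)
      window′ = subst₂ (λ a b → take (suc (j ∸ k)) (drop a S) ≡ take (suc (j ∸ k)) (drop b S))
                  (sym (+-∸-comm (k ∸ i) 1≤p)) (i∸1+[k∸i]≡k∸1 1≤i i≤k)
                  (take-suffix (k ∸ i) (suc (j ∸ k)) (p ∸ 1) (i ∸ 1) S window)

  Repeating-prefix : ∀ {i k j} → i ≤ k → k ≤ j → Repeating S i j → Repeating S i k
  Repeating-prefix {i} {k} i≤k k≤j (occᵢ , p , _ , occₚ , p≢i) =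
    Occ-prefix i≤k k≤j occᵢ , p , Occ⇒< {i} {k} occ , occ , p≢i
    where
      occ : Occ S i k p
      occ = Occ-prefix i≤k k≤j occₚ

  Repeating-suffix : ∀ {i k j} → i ≤ k → k ≤ j → Repeating S i j → Repeating S k j
  Repeating-suffix {i} {k} {j} i≤k k≤j (occᵢ@(1≤i , _) , p , _ , occₚ , p≢i) =
    subst (Occ S k j) (m+[n∸m]≡n i≤k) (Occ-suffix 1≤i i≤k k≤j occᵢ) ,
    p + (k ∸ i) , Occ⇒< {k} {j} occ , occ , shifted≢k
    where
      occ : Occ S k j (p + (k ∸ i))
      occ = Occ-suffix 1≤i i≤k k≤j occₚ
      shifted≢k : p + (k ∸ i) ≢ k
      shifted≢k eq = p≢i (+-cancelʳ-≡ (k ∸ i) p i (trans eq (sym (m+[n∸m]≡n i≤k))))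

  Repeating⇒¬Unique : ∀ {i j} → Repeating S i j → ¬ Unique S i j
  Repeating⇒¬Unique (_ , p , p<n , occ , p≢i) (_ , only) = p≢i (only p p<n occ)

module _ {A : Set} (S : List A) where

  LeftMinimalUnique : ℕ → ℕ → Set
  LeftMinimalUnique i j = Valid S i j × Unique S i j × (i < j → Repeating S (suc i) j)

  RightMinimalUnique : ℕ → ℕ → Set
  RightMinimalUnique i j = Valid S i j × Unique S i j × (i < j → Repeating S i (pred j))

module _ {A : Set} (_≟A_ : DecidableEquality A) (S : List A) where

  LeftMinimalUnique? : ∀ i j → Dec (LeftMinimalUnique S i j)
  LeftMinimalUnique? i j =
    Valid? _≟A_ S i j ×-dec Unique? _≟A_ S i j ×-dec (i <? j →-dec Repeating? _≟A_ S (suc i) j)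

  RightMinimalUnique? : ∀ i j → Dec (RightMinimalUnique S i j)
  RightMinimalUnique? i j =
    Valid? _≟A_ S i j ×-dec Unique? _≟A_ S i j ×-dec (i <? j →-dec Repeating? _≟A_ S i (pred j))

module _ {A : Set} {S : List A} where

  leftMinimal-maximal : ∀ {i i′ j} → LeftMinimalUnique S i j → Unique S i′ j → i′ ≤ j → ¬ i < i′
  leftMinimal-maximal (_ , _ , shrunk) unique′ i′≤j i<i′ =
    Repeating⇒¬Unique (Repeating-suffix i<i′ i′≤j (shrunk (<-≤-trans i<i′ i′≤j))) unique′

  rightMinimal-minimal : ∀ {i j j′} → RightMinimalUnique S i j → Unique S i j′ → i ≤ j′ → ¬ j′ < j
  rightMinimal-minimal (_ , _ , shrunk) unique′ i≤j′ j′<j =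
    Repeating⇒¬Unique (Repeating-prefix i≤j′ (pred-mono-≤ j′<j) (shrunk (≤-<-trans i≤j′ j′<j))) unique′

  leftMinimal-start-unique : ∀ {i i′ j} → LeftMinimalUnique S i j → LeftMinimalUnique S i′ j → i ≡ i′
  leftMinimal-start-unique l@((_ , i≤j , _) , u , _) l′@((_ , i′≤j , _) , u′ , _) =
    ≤-antisym (≮⇒≥ (leftMinimal-maximal l′ u i≤j)) (≮⇒≥ (leftMinimal-maximal l u′ i′≤j))

  rightMinimal-end-unique : ∀ {i j j′} → RightMinimalUnique S i j → RightMinimalUnique S i j′ → j ≡ j′
  rightMinimal-end-unique r@((_ , i≤j , _) , u , _) r′@((_ , i≤j′ , _) , u′ , _) =
    ≤-antisym (≮⇒≥ (rightMinimal-minimal r u′ i≤j′)) (≮⇒≥ (rightMinimal-minimal r′ u i≤j))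

  MUS⇒leftMinimal : ∀ {i j} → MUS S i j → LeftMinimalUnique S i j
  MUS⇒leftMinimal {i} (v@(_ , _ , j≤n) , u , minimal) = v , u , λ i<j →
    minimal (suc i) (s≤s (≤-trans i<j j≤n)) _ (s≤s j≤n) (n≤1+n i) ≤-refl i<j (j∸[1+i]<j∸i i<j)

  MUS⇒rightMinimal : ∀ {i j} → MUS S i j → RightMinimalUnique S i j
  MUS⇒rightMinimal {i} {j} (v@(_ , i≤j , j≤n) , u , minimal) = v , u , λ i<j →
    minimal i (s≤s (≤-trans i≤j j≤n)) (pred j) (s≤s (≤-trans pred[n]≤n j≤n))
      ≤-refl pred[n]≤n (pred-mono-≤ i<j) (pred[j]∸i<j∸i i<j)

  IS⇒leftMinimal⊎rightMinimal : ∀ {i j} → IS S i j → LeftMinimalUnique S i j ⊎ RightMinimalUnique S i j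
  IS⇒leftMinimal⊎rightMinimal {i} {j}
    (s , _ , t , _ , (_ , nontrivial) , (v@(1≤i , i≤j , j≤n) , u , i≤s , t≤j , shortest))
    with i <? s | t <? j
  ... | yes i<s | _ = inj₁ (v , u , λ i<j →
        shortest (suc i) (s≤s (≤-trans i<j j≤n)) j (s≤s j≤n) (s≤s z≤n , i<j , j≤n)
          i<s t≤j (j∸[1+i]<j∸i i<j))
  ... | no _ | yes t<j = inj₂ (v , u , λ i<j →
        shortest i (s≤s (≤-trans i≤j j≤n)) (pred j) (s≤s (≤-trans pred[n]≤n j≤n))
          (1≤i , pred-mono-≤ i<j , ≤-trans pred[n]≤n j≤n) i≤s (pred-mono-≤ t<j) (pred[j]∸i<j∸i i<j))
  ... | no i≮s | no t≮j with ≤∧≮⇒≡ i≤s i≮s | ≤∧≮⇒≡ t≤j t≮j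
  ... | refl | refl = inj₁ (v , u , λ i<j → ⊥-elim (nontrivial (<⇒≢ i<j , u)))

module _ {B : Set} where

  length-filter-mono : ∀ {p q} {P : Pred B p} {Q : Pred B q} (P? : Decidable P) (Q? : Decidable Q) →
                       P ⊆ Q → ∀ xs → length (filter P? xs) ≤ length (filter Q? xs)
  length-filter-mono P? Q? P⊆Q xs =
    Sublist.length-mono-≤ (Sublist.filter⁺ P? Q? (λ { refl → P⊆Q }) (⊆-refl {x = xs}))

  length-filter-∪+∩ : ∀ {p q} {P : Pred B p} {Q : Pred B q} (P? : Decidable P) (Q? : Decidable Q) xs →
    length (filter (λ x → P? x ⊎-dec Q? x) xs) + length (filter (λ x → P? x ×-dec Q? x) xs)
    ≡ length (filter P? xs) + length (filter Q? xs)
  length-filter-∪+∩ P? Q? [] = refl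
  length-filter-∪+∩ P? Q? (x ∷ xs) with ih ← length-filter-∪+∩ P? Q? xs | P? x | Q? x
  ... | yes _ | yes _ = cong suc (trans (+-suc _ _) (trans (cong suc ih) (sym (+-suc _ _))))
  ... | yes _ | no _  = cong suc ih
  ... | no _  | yes _ = trans (cong suc ih) (sym (+-suc _ _))
  ... | no _  | no _  = ih

  Distinct-map⁺ : ∀ {C : Set} {p} {P : Pred B p} (f : B → C) →
                  (∀ {x y} → P x → P y → f x ≡ f y → x ≡ y) →
                  ∀ {xs} → All P xs → Distinct xs → Distinct (map f xs)
  Distinct-map⁺ f injective [] [] = []
  Distinct-map⁺ f injective (px ∷ pxs) (x∉ ∷ distinct) =
    All.map⁺ (All.zipWith (λ (x≢y , py) → x≢y ∘ injective px py) (x∉ , pxs))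
    ∷ Distinct-map⁺ f injective pxs distinct

length≤1+length-filter-≢ : ∀ k {ms} → Distinct ms →
                           length ms ≤ suc (length (filter (λ m → ¬? (m ≟ k)) ms))
length≤1+length-filter-≢ k [] = z≤n
length≤1+length-filter-≢ k {m ∷ ms} (m∉ ∷ distinct) with m ≟ k
... | no m≢k = begin
  suc (length ms)                    ≤⟨ s≤s (length≤1+length-filter-≢ k distinct) ⟩
  suc (length (m ∷ filter ≢k? ms))   ≡⟨ cong (suc ∘ length) (filter-accept ≢k? m≢k) ⟨
  suc (length (filter ≢k? (m ∷ ms))) ∎
  where open ≤-Reasoning
        ≢k? = λ m′ → ¬? (m′ ≟ k)
... | yes refl = begin
  suc (length ms)                    ≡⟨ cong (suc ∘ length) (filter-all ≢m? (All.map (λ m≢m′ → m≢m′ ∘ sym) m∉)) ⟨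
  suc (length (filter ≢m? ms))       ≡⟨ cong (suc ∘ length) (filter-reject ≢m? (λ m≢m → m≢m refl)) ⟨
  suc (length (filter ≢m? (m ∷ ms))) ∎
  where open ≤-Reasoning
        ≢m? = λ m′ → ¬? (m′ ≟ m)

Distinct⇒length≤ : ∀ n {ms} → Distinct ms → All (λ m → 1 ≤ m × m ≤ n) ms → length ms ≤ n
Distinct⇒length≤ zero [] [] = z≤n
Distinct⇒length≤ zero (_ ∷ _) ((1≤m , m≤0) ∷ _) = ⊥-elim (<-irrefl refl (≤-trans 1≤m m≤0))
Distinct⇒length≤ (suc n) {ms} distinct bounded =
  ≤-trans (length≤1+length-filter-≢ (suc n) distinct)
    (s≤s (Distinct⇒length≤ n (Distinct.filter⁺ ≢? distinct)
      (All.zipWith (λ ((1≤m , m≤1+n) , m≢1+n) → 1≤m , ≤-pred (≤∧≢⇒< m≤1+n m≢1+n))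
        (All.filter⁺ ≢? bounded , all-filter ≢? ms))))
  where ≢? = λ m → ¬? (m ≟ suc n)

allPairs-distinct : ∀ n → Distinct (allPairs n)
allPairs-distinct n = Distinct.cartesianProduct⁺ (Distinct.upTo⁺ (suc n)) (Distinct.upTo⁺ (suc n))

module _ {P : ℕ → ℕ → Set} (P? : ∀ i j → Dec (P i j)) (n : ℕ) where

  private
    P⃗ : Pred (ℕ × ℕ) _
    P⃗ (i , j) = P i j
    P⃗? : Decidable P⃗
    P⃗? (i , j) = P? i j

  card-mono : ∀ {Q : ℕ → ℕ → Set} (Q? : ∀ i j → Dec (Q i j)) →
              (∀ {i j} → P i j → Q i j) → card P P? n ≤ card Q Q? n
  card-mono Q? P⇒Q = length-filter-mono P⃗? (λ (i , j) → Q? i j) P⇒Q (allPairs n)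

  card-∪+card-∩ : ∀ {Q : ℕ → ℕ → Set} (Q? : ∀ i j → Dec (Q i j)) →
    card (λ i j → P i j ⊎ Q i j) (λ i j → P? i j ⊎-dec Q? i j) n
      + card (λ i j → P i j × Q i j) (λ i j → P? i j ×-dec Q? i j) n
    ≡ card P P? n + card Q Q? n
  card-∪+card-∩ Q? = length-filter-∪+∩ P⃗? (λ (i , j) → Q? i j) (allPairs n)

  card≤-injective : (f : ℕ × ℕ → ℕ) → (∀ {x} → P⃗ x → 1 ≤ f x × f x ≤ n) →
                    (∀ {x y} → P⃗ x → P⃗ y → f x ≡ f y → x ≡ y) → card P P? n ≤ n
  card≤-injective f bounded injective = subst (_≤ n) (length-map f selected)
    (Distinct⇒length≤ n
      (Distinct-map⁺ f injective (all-filter P⃗? (allPairs n))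
        (Distinct.filter⁺ P⃗? (allPairs-distinct n)))
      (All.map⁺ (All.map bounded (all-filter P⃗? (allPairs n)))))
    where selected = filter P⃗? (allPairs n)

  card≤-byEnd : (∀ {i j} → P i j → 1 ≤ j × j ≤ n) → (∀ {i i′ j} → P i j → P i′ j → i ≡ i′) →
                card P P? n ≤ n
  card≤-byEnd bounded endDetermines =
    card≤-injective proj₂ bounded λ { p p′ refl → cong (_, _) (endDetermines p p′) }

  card≤-byStart : (∀ {i j} → P i j → 1 ≤ i × i ≤ n) → (∀ {i j j′} → P i j → P i j′ → j ≡ j′) →
                  card P P? n ≤ n
  card≤-byStart bounded startDetermines =
    card≤-injective proj₁ bounded λ { p p′ refl → cong (_ ,_) (startDetermines p p′) }

lemma7 : {A : Set} (_≟_ : DecidableEquality A) (S : List A) → S ≢ [] →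
    #IS _≟_ S ≤ 2 * length S ∸ #MUS _≟_ S
lemma7 _≟_ S _ = m+n≤o⇒m≤o∸n (#IS _≟_ S) (begin
  #IS _≟_ S + #MUS _≟_ S
    ≤⟨ +-mono-≤ (card-mono (IS? _≟_ S) n L∪R? IS⇒leftMinimal⊎rightMinimal)
                (card-mono (MUS? _≟_ S) n L∩R? λ m → MUS⇒leftMinimal m , MUS⇒rightMinimal m) ⟩
  card _ L∪R? n + card _ L∩R? n
    ≡⟨ card-∪+card-∩ L? n R? ⟩
  card _ L? n + card _ R? n
    ≤⟨ +-mono-≤ (card≤-byEnd L? n (λ ((1≤i , i≤j , j≤n) , _) → ≤-trans 1≤i i≤j , j≤n)
                               leftMinimal-start-unique)
                (card≤-byStart R? n (λ ((1≤i , i≤j , j≤n) , _) → 1≤i , ≤-trans i≤j j≤n)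
                               rightMinimal-end-unique) ⟩
  n + n
    ≡⟨ cong (n +_) (+-identityʳ n) ⟨
  2 * n ∎)
  where
    open ≤-Reasoning
    n = length S
    L? = LeftMinimalUnique? _≟_ S
    R? = RightMinimalUnique? _≟_ S
    L∪R? = λ i j → L? i j ⊎-dec R? i j
    L∩R? = λ i j → L? i j ×-dec R? i j
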